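{- For every atomic system $S$ and every $p\in\mathsf{At}_\bot$, $\Vdash^L_S p^c$ if and only if $p^i\nVdash^L_S\bot$.
   Context: Basic setting. Let $\mathsf{At}$ be a countably infinite set of atomic propositions and $\mathsf{At}_\bot=\mathsf{At}\cup\{\bot\}$. An atomic rule has the form "from premises $p_1,\dots,p_n$ ($n\ge 0$) infer $p$", with $p_j,p\in\mathsf{At}_\bot$, where the derivation of each premise may discharge a set of basic sentences. An atomic system $S$ is a set of atomic rules; $S\subseteq S'$ ($S'$ extends $S$) if $S'$ contains all rules of $S$. $\Delta\vdash_S p$ means there is a natural-deduction derivation using only rules of $S$ with conclusion $p$ and undischarged assumptions in $\Delta$ (so $p\vdash_S p$). $S$ is consistent if $\nvdash_S\bot$. Standing convention: all atomic systems (including all extensions quantified over) are required to be consistent. Ecumenical formulas: $p^i,p^c$ for $p\in\mathsf{At}_\bot$; $(A\wedge B)^x,(A\vee B)^x,(A\to B)^x$ for $x\in\{i,c\}$. In semantic statements $\bot$ denotes $\bot^i$; for $X^c$, $X^i$ is the same construction with outer superscript $i$. Weak validity (by simultaneous recursion): (1) $\Vdash^L_S p^i$ iff $\vdash_S p$ ($p\in\mathsf{At}_\bot$); (2) $\Vdash^L_S p^c$ iff $p\nvdash_S\bot$; (3) for non-atomic $X$, $\Vdash^L_S X^c$ iff $X^i\nVdash^L_S\bot$; (4) $\Vdash^L_S(A\wedge B)^i$ iff $\Vdash^L_S A$ and $\Vdash^L_S B$; (5) $\Vdash^L_S(A\to B)^i$ iff $A\Vdash^G_S B$; (6) $\Vdash^L_S(A\vee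 B)^i$ iff for all $S'\supseteq S$ and all $p\in\mathsf{At}_\bot$, if $A\Vdash^L_{S'}p^i$ and $B\Vdash^L_{S'}p^i$ then $\Vdash^L_{S'}p^i$; (7) for nonempty $\Gamma$, $\Gamma\Vdash^L_S A$ iff for all $S'\supseteq S$, if $\Vdash^L_{S'}B$ for all $B\in\Gamma$ then $\Vdash^L_{S'}A$; (8) $\Gamma\Vdash^G_S A$ iff for all $S'\supseteq S$: if $\Vdash^L_{S''}B$ for all $B\in\Gamma$ and all $S''\supseteq S'$, then $\Vdash^L_{S''}A$ for all $S''\supseteq S'$. -}

module Defs where

open import Level using (Lift) renaming (suc to lsuc; zero to lzero)
open import Data.Nat using (ℕ)
open import Data.Fin using (Fin)
open import Data.List using (List)
open import Data.List.Membership.Propositional using (_∈_)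
open import Data.Sum using (_⊎_)
open import Data.Product using (_×_)
open import Data.Empty using (⊥)
open import Relation.Nullary using (¬_)
open import Relation.Binary.PropositionalEquality using (_≡_)

At : Set
At = ℕ

data At⊥ : Set where
  atom : At → At⊥
  bot  : At⊥

-- An atomic rule: n premises; premise j is p_j, whose derivation may
-- discharge the (finite) set of basic sentences disch j; conclusion concl.
record Rule : Set where
  field
    n      : ℕ
    disch  : Fin n → List At⊥
    prem   : Fin n → At⊥
    concl  : At⊥
open Rule public

System : Set₁
System = Rule → Set

_⊆S_ : System → System → Set
S ⊆S S' = ∀ r → S r → S' r

Assm : Set₁
Assm = At⊥ → Set

∅ : Assm
∅ _ = ⊥

⟨_⟩ : At⊥ → Assm
⟨ p ⟩ q = q ≡ p

_∪L_ : Assm → List At⊥ → Assm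
(Δ ∪L Γ) q = Δ q ⊎ q ∈ Γ

data Derivable (S : System) (Δ : Assm) : At⊥ → Set where
  assume : ∀ {p} → Δ p → Derivable S Δ p
  apply  : (r : Rule) → S r →
           ((j : Fin (n r)) → Derivable S (Δ ∪L disch r j) (prem r j)) →
           Derivable S Δ (concl r)

Consistent : System → Set
Consistent S = ¬ Derivable S ∅ bot

data Tag : Set where
  i c : Tag

data Formula : Set where
  atm  : Tag → At⊥ → Formula
  _∧[_]_ : Formula → Tag → Formula → Formula
  _∨[_]_ : Formula → Tag → Formula → Formula
  _⇒[_]_ : Formula → Tag → Formula → Formula

-- Weak validity ⊩^L_S A (all extensions quantified over are consistent).
-- The intuitionistic clauses of each connective are given by auxiliary
-- functions so that the classical clause (3) can refer to them.
mutual
  ⊩L : System → Formula → Set₁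
  ⊩L S (atm i p) = Lift (lsuc lzero) (Derivable S ∅ p)
  ⊩L S (atm c p) = Lift (lsuc lzero) (¬ Derivable S ⟨ p ⟩ bot)
  ⊩L S (A ∧[ i ] B) = ∧i S A B
  ⊩L S (A ∨[ i ] B) = ∨i S A B
  ⊩L S (A ⇒[ i ] B) = ⇒i S A B
  -- (3): X^c valid iff X^i ⊮^L_S ⊥, with (7) unfolded
  ⊩L S (A ∧[ c ] B) = ¬ (∀ S' → S ⊆S S' → Consistent S' → ∧i S' A B → Derivable S' ∅ bot)
  ⊩L S (A ∨[ c ] B) = ¬ (∀ S' → S ⊆S S' → Consistent S' → ∨i S' A B → Derivable S' ∅ bot)
  ⊩L S (A ⇒[ c ] B) = ¬ (∀ S' → S ⊆S S' → Consistent S' → ⇒i S' A B → Derivable S' ∅ bot)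

  ∧i : System → Formula → Formula → Set₁
  ∧i S A B = ⊩L S A × ⊩L S B

  -- (5) with (8) unfolded: A ⊩^G_S B
  ⇒i : System → Formula → Formula → Set₁
  ⇒i S A B = ∀ S' → S ⊆S S' → Consistent S' →
               (∀ S'' → S' ⊆S S'' → Consistent S'' → ⊩L S'' A) →
               (∀ S'' → S' ⊆S S'' → Consistent S'' → ⊩L S'' B)

  -- (6) with (7) unfolded for A ⊩^L_{S'} p^i
  ∨i : System → Formula → Formula → Set₁
  ∨i S A B = ∀ S' → S ⊆S S' → Consistent S' → (p : At⊥) →
               (∀ S'' → S' ⊆S S'' → Consistent S'' → ⊩L S'' A → Derivable S'' ∅ p) →
               (∀ S'' → S' ⊆S S'' → Consistent S'' → ⊩L S'' B → Derivable S'' ∅ p) →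
               Derivable S' ∅ p

-- (7) for a single premise: A ⊩^L_S B
_⊩L[_]_ : Formula → System → Formula → Set₁
A ⊩L[ S ] B = ∀ S' → S ⊆S S' → Consistent S' → ⊩L S' A → ⊩L S' B

-- In semantic statements ⊥ denotes ⊥^i
⊥F : Formula
⊥F = atm i bot

module Submission where

open import Defs
open import Function.Base using (_∘′_)
open import Function.Bundles using (_⇔_; mk⇔)
open import Relation.Nullary using (¬_)
open import Level using (lift; lower)
open import Data.Sum using (_⊎_; inj₁; inj₂)
open import Data.Sum.Base using ([_,_]′; map₁)
open import Relation.Binary.PropositionalEquality using (_≡_; refl)

-- If p ⊬_S ⊥, then S extended by the axiom p is a consistent extension in which p^i holds
-- but ⊥ does not, so p^i ⊮ ⊥.  Conversely, if p ⊢_S ⊥, then in every extension proving p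
-- the derivation of ⊥ from p can be cut against the proof of p, so p^i ⊩ ⊥.

_⊆A_ : Assm → Assm → Set
Δ ⊆A Γ = ∀ x → Δ x → Γ x

derivable-weaken : ∀ {S Δ Γ q} → Δ ⊆A Γ → Derivable S Δ q → Derivable S Γ q
derivable-weaken Δ⊆Γ (assume x)      = assume (Δ⊆Γ _ x)
derivable-weaken Δ⊆Γ (apply r s ds) =
  apply r s λ j → derivable-weaken (λ x → map₁ (Δ⊆Γ x)) (ds j)

derivable-cut : ∀ {S S' Δ Γ q} → S ⊆S S' → (∀ x → Δ x → Derivable S' Γ x) →
                Derivable S Δ q → Derivable S' Γ q
derivable-cut S⊆S' Δ⊢ (assume x)      = Δ⊢ _ x
derivable-cut S⊆S' Δ⊢ (apply r s ds) = apply r (S⊆S' r s) λ j → derivable-cut S⊆S'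
  (λ x → [ derivable-weaken (λ _ → inj₁) ∘′ Δ⊢ x , assume ∘′ inj₂ ]′) (ds j)

axiom : At⊥ → Rule
axiom p = record { n = 0 ; disch = λ () ; prem = λ () ; concl = p }

_+axiom_ : System → At⊥ → System
(S +axiom p) r = S r ⊎ (r ≡ axiom p)

⊆S-+axiom : ∀ S p → S ⊆S (S +axiom p)
⊆S-+axiom S p r = inj₁

+axiom-proves : ∀ S p → Derivable (S +axiom p) ∅ p
+axiom-proves S p = apply (axiom p) (inj₂ refl) λ ()

+axiom-eliminate : ∀ {S p Δ Γ q} → Δ ⊆A Γ → Γ p →
                   Derivable (S +axiom p) Δ q → Derivable S Γ q
+axiom-eliminate Δ⊆Γ Γp (assume x)              = assume (Δ⊆Γ _ x)
+axiom-eliminate Δ⊆Γ Γp (apply r (inj₁ s) ds)  =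
  apply r s λ j → +axiom-eliminate (λ x → map₁ (Δ⊆Γ x)) (inj₁ Γp) (ds j)
+axiom-eliminate Δ⊆Γ Γp (apply _ (inj₂ refl) _) = assume Γp

+axiom-consistent : ∀ {S p} → ¬ Derivable S ⟨ p ⟩ bot → Consistent (S +axiom p)
+axiom-consistent p⊬⊥ ⊢⊥ = p⊬⊥ (+axiom-eliminate (λ _ ()) refl ⊢⊥)

corollary1 : (S : System) → Consistent S → (p : At⊥) →
    ⊩L S (atm c p) ⇔ (¬ (atm i p ⊩L[ S ] ⊥F))
corollary1 S _ p = mk⇔ to from
  where
  to : ⊩L S (atm c p) → ¬ (atm i p ⊩L[ S ] ⊥F)
  to (lift p⊬⊥) p⊩⊥ = +axiom-consistent p⊬⊥ (lower
    (p⊩⊥ (S +axiom p) (⊆S-+axiom S p) (+axiom-consistent p⊬⊥) (lift (+axiom-proves S p))))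

  from : ¬ (atm i p ⊩L[ S ] ⊥F) → ⊩L S (atm c p)
  from p⊮⊥ = lift λ p⊢⊥ → p⊮⊥ λ { S' S⊆S' _ (lift ⊢p) →
    lift (derivable-cut S⊆S' (λ { _ refl → ⊢p }) p⊢⊥) }
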